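{- Let $G$ be a graph on $V=\{v_1,\dots,v_n\}$ with a linear order $v_1\prec v_2\prec\cdots\prec v_n$, and order the maximal faces of $NC(G)$ and define $\mathrm{mes}$ as in the context. Then for every face $\sigma\in NC(G)$ there exists a face $\sigma'\in NC(G)$ such that $\mathrm{mes}(\sigma)=\mathrm{mes}(\sigma')$ and the subgraph of $G$ induced by the complement $V\setminus\sigma'$ is the disjoint union of isolated vertices $b_{k+1},\dots,b_{k+m}$ and a star with center $a$ and leaves $b_1,\dots,b_k$ (i.e. a copy of $K_{1,k}$ in which $a$ is adjacent to each $b_i$, $1\le i\le k$, and the $b_i$ have degree $1$ in it); moreover $a\prec b_i$ for each $1\le i\le k$.
   Context: A set $W\subset V$ is a cover of $G$ if $V\setminus W$ is an independent set, and a noncover otherwise; $NC(G)$ is the simplicial complex on $V$ whose faces are the noncovers of $G$. Its maximal faces are exactly the sets $V\setminus e$ for edges $e\in E(G)$. Order edges lexicographically: for distinct edges $e=uv$, $e'=u'v'$ with $u\prec v$, $u'\prec v'$, set $e\prec_e e'$ iff $u\prec u'$, or $u=u'$ and $v\prec v'$. Write $E(G)=\{e_1,\dots,e_m\}$ with $e_m\prec_e e_{m-1}\prec_e\cdots\prec_e e_1$, and let $\sigma_j=V\setminus e_j$, so the maximal faces are ordered $\sigma_1,\sigma_2,\dots,\sigma_m$. For a face $\sigma$, let $i(\sigma)=\min\{j:\sigma\subset\sigma_j\}$. The minimal exclusion sequence $\mathrm{mes}(\sigma)=(w_1,\dots,w_{i-1})$ with $i=i(\sigma)$ is empty if $i=1$,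 and otherwise for each $j\in[i-1]$, $w_j$ is the $\prec$-minimal element of $\sigma\setminus\sigma_j$ if $(\sigma\setminus\sigma_j)\cap\{w_1,\dots,w_{j-1}\}=\emptyset$, and the $\prec$-minimal element of $(\sigma\setminus\sigma_j)\cap\{w_1,\dots,w_{j-1}\}$ otherwise. -}

module Defs where

open import Data.Nat using (ℕ)
open import Data.Fin using (Fin; _<_; _<?_)
open import Data.Fin.Properties using (_≟_)
open import Data.Fin.Subset using (Subset; _∈_; ∁)
open import Data.Fin.Subset.Properties using (_∈?_)
open import Data.Bool using (Bool; true; false; _∧_; if_then_else_)
open import Data.List using (List; []; _∷_; _++_; [_]; reverse; concatMap; filterᵇ; map; allFin)
import Data.List.Membership.DecPropositional as DecMem
open import Data.Product using (_×_; _,_; ∃; ∃-syntax)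
open import Data.Sum using (_⊎_)
open import Relation.Nullary using (does)
open import Relation.Binary.PropositionalEquality using (_≡_)

-- A finite simple graph on the vertex set Fin n; the linear order
-- v₁ ≺ … ≺ vₙ on vertices is the order _<_ of Fin n.
record Graph (n : ℕ) : Set where
  field
    adj    : Fin n → Fin n → Bool
    sym    : ∀ u v → adj u v ≡ adj v u
    irrefl : ∀ u → adj u u ≡ false
open Graph public

NotIndependent : ∀ {n} → Graph n → Subset n → Set
NotIndependent G S = ∃[ u ] ∃[ v ] (u ∈ S × v ∈ S × adj G u v ≡ true)

-- σ is a noncover of G, i.e. a face of NC(G): V ∖ σ is not independent.
IsFace : ∀ {n} → Graph n → Subset n → Set
IsFace G σ = NotIndependent G (∁ σ)

edgesAsc : ∀ {n} → Graph n → List (Fin n × Fin n)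
edgesAsc {n} G =
  concatMap (λ u → map (λ v → (u , v))
                      (filterᵇ (λ v → does (u <? v) ∧ adj G u v) (allFin n)))
            (allFin n)

-- e₁ , e₂ , … , eₘ  with  eₘ ≺ₑ … ≺ₑ e₁  (decreasing lexicographic order);
-- σⱼ = V ∖ eⱼ.
edgeSeq : ∀ {n} → Graph n → List (Fin n × Fin n)
edgeSeq G = reverse (edgesAsc G)

-- One step of the minimal exclusion sequence: given σ, eⱼ = (u , v) with
-- u ≺ v (so σ ∖ σⱼ = σ ∩ {u , v}) and the previous entries w₁ … w_{j-1}.
mesStep : ∀ {n} → Subset n → List (Fin n) → Fin n → Fin n → Fin n
mesStep {n} σ ws u v =
  let inS = λ x → does (x ∈? σ)
      inT = λ x → inS x ∧ does (DecMem._∈?_ (_≟_ {n}) x ws)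
  in if inT u then u else if inT v then v else if inS u then u else v

-- Walk through σ₁ , σ₂ , … ; stop at the first j with σ ⊆ σⱼ (i.e. σ
-- disjoint from eⱼ), which is j = i(σ).  ws holds (w₁ , … , w_{j-1}).
mesAux : ∀ {n} → Subset n → List (Fin n) → List (Fin n × Fin n) → List (Fin n)
mesAux σ ws [] = ws   -- only reached when σ is not a face
mesAux σ ws ((u , v) ∷ es) with does (u ∈? σ) | does (v ∈? σ)
... | false | false = ws
... | _     | _     = mesAux σ (ws ++ [ mesStep σ ws u v ]) es

mes : ∀ {n} → Graph n → Subset n → List (Fin n)
mes G σ = mesAux σ [] (edgeSeq G)

-- The induced subgraph G[S] is a star with center a (a ∈ S) together with
-- isolated vertices, and every leaf b satisfies a ≺ b: every edge of G[S]
-- joins a to some b ∈ S with a ≺ b.  (Leaves = neighbours of a in S; the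
-- remaining vertices of S are isolated.)
StarWithCenter : ∀ {n} → Graph n → Subset n → Fin n → Set
StarWithCenter G S a =
  a ∈ S ×
  (∀ u v → u ∈ S → v ∈ S → adj G u v ≡ true →
     (u ≡ a × a < v) ⊎ (v ≡ a × a < u))

-- Let e_i = ab (a ≺ b) be the first edge of the sequence missed by σ, so that
-- W = mes(σ) = (w_1, …, w_{i-1}) lies in σ and w_j ∈ e_j.  Put σ' = W ∪ {x ∣ x ≺ a}.
-- Each e_j with j < i still meets σ' (in w_j) while ab misses it, so i(σ') = i(σ).
-- Once w_1, …, w_{j-1} lie in both σ and σ', the rule producing w_j only asks
-- whether the smaller endpoint of e_j is in the face; the edges before ab all start
-- at a vertex ≽ a, and such a vertex lies in σ' only if it lies in W ⊆ σ.  Hence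
-- mes(σ') = mes(σ).  Finally an edge uv (u ≺ v) of G outside σ' has a ≼ u, and if
-- a ≺ u it precedes ab, so it contains some w_j ∈ σ'; thus every such edge starts at a.
module Submission where

open import Defs
open import Data.Nat using (ℕ)
open import Data.Fin.Subset using (Subset; ∁)
open import Data.Product using (_×_; ∃-syntax)
open import Relation.Binary.PropositionalEquality using (_≡_)

open import Level using (Level)
open import Function using (id; _∘_; _on_; flip; Equivalence)
open import Data.Bool using (Bool; true; _∧_; T?)
open import Data.Bool.Properties using (∧-zeroʳ; T-∧; T-≡)
open import Data.Empty using (⊥-elim)
open import Data.Product using (_,_; proj₁; proj₂)
open import Data.Sum as Sum using (_⊎_; inj₁; inj₂; [_,_]′)
open import Data.Fin using (Fin; _≤_; _<_; _<?_)
open import Data.Fin.Properties using (_≟_; <-cmp)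
import Data.Nat.Properties as ℕ
open import Data.Fin.Subset using (_∈_; _∉_)
open import Data.Fin.Subset.Properties using (_∈?_; x∈∁p⇒x∉p; x∉p⇒x∈∁p)
open import Data.Vec using (tabulate)
open import Data.Vec.Properties using (lookup∘tabulate; lookup⇒[]=; []=⇒lookup)
open import Data.List using (List; []; _∷_; _++_; [_]; reverse; map; filterᵇ; allFin)
open import Data.List.Properties using (unfold-reverse)
open import Data.List.Membership.Propositional using (find; lose) renaming (_∈_ to _∈ₗ_)
open import Data.List.Membership.Propositional.Properties
  using ( ∈-++⁺ˡ; ∈-++⁺ʳ; ∈-++⁻; ∈-map⁺; ∈-map⁻; ∈-filter⁺; ∈-filter⁻; ∈-allFin
        ; ∈-concatMap⁺; ∈-concatMap⁻)
open import Data.List.Relation.Binary.Subset.Propositional using () renaming (_⊆_ to _⊆ₗ_)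
open import Data.List.Relation.Unary.All as All using (All; []; _∷_)
import Data.List.Relation.Unary.All.Properties as Allₚ
open import Data.List.Relation.Unary.AllPairs using (AllPairs; []; _∷_)
import Data.List.Relation.Unary.AllPairs.Properties as AllPairsₚ
open import Data.List.Relation.Unary.Any using (Any; here; there; any?)
import Data.List.Relation.Unary.Any.Properties as Anyₚ
import Data.List.Relation.Unary.First as First
open import Data.List.Relation.Unary.First using (First; FirstView; fromAny; refine)
open import Data.List.Relation.Unary.First.Properties using (toView)
open import Relation.Binary using (Rel; tri<; tri≈; tri>)
import Relation.Binary.PropositionalEquality as ≡
open import Relation.Binary.PropositionalEquality
  using (refl; trans; cong; subst; subst₂; module ≡-Reasoning)
open import Relation.Nullary using (¬_; yes; no; does)
open import Relation.Nullary.Decidable using (dec-true; dec-false; _⊎-dec_)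
open import Relation.Unary using (Pred; Decidable)

private
  variable
    ℓ : Level
    A : Set
    n : ℕ
    σ τ : Subset n
    u v x : Fin n

subset : {P : Pred (Fin n) ℓ} → Decidable P → Subset n
subset P? = tabulate (does ∘ P?)

module _ {P : Pred (Fin n) ℓ} (P? : Decidable P) where

  ∈-subset⁺ : P x → x ∈ subset P?
  ∈-subset⁺ {x} px =
    lookup⇒[]= x (subset P?) (trans (lookup∘tabulate (does ∘ P?) x) (dec-true (P? x) px))

  ∈-subset⁻ : x ∈ subset P? → P x
  ∈-subset⁻ {x} x∈ with P? x | trans (≡.sym (lookup∘tabulate (does ∘ P?) x)) ([]=⇒lookup x∈)
  ... | yes px | _ = px

AllPairs-reverse⁺ : {R : Rel A ℓ} {xs : List A} → AllPairs R xs → AllPairs (flip R) (reverse xs)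
AllPairs-reverse⁺ [] = []
AllPairs-reverse⁺ {xs = x ∷ xs} (Rx ∷ Rxs) rewrite unfold-reverse x xs =
  AllPairsₚ.++⁺ (AllPairs-reverse⁺ Rxs) ([] ∷ [])
    (All.tabulate λ y∈ → All.lookup Rx (Anyₚ.reverse⁻ y∈) ∷ [])

AllPairs-middle⁻ : {R : Rel A ℓ} (xs : List A) {y : A} {ys : List A} →
  AllPairs R (xs ++ y ∷ ys) → All (flip R y) xs × All (R y) ys
AllPairs-middle⁻ [] (Ry ∷ _) = [] , Ry
AllPairs-middle⁻ (x ∷ xs) (Rx ∷ Rxs) with AllPairs-middle⁻ xs Rxs
... | before , after = All.head (Allₚ.++⁻ʳ xs Rx) ∷ before , after

Edge : ℕ → Set
Edge n = Fin n × Fin n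

Meets : Pred (Fin n) ℓ → Pred (Edge n) ℓ
Meets P (u , v) = P u ⊎ P v

Both : Pred (Fin n) ℓ → Pred (Edge n) ℓ
Both P (u , v) = P u × P v

meets-or-misses : (σ : Subset n) (e : Edge n) → Meets (_∈ σ) e ⊎ Both (_∉ σ) e
meets-or-misses σ (u , v) with u ∈? σ | v ∈? σ
... | yes u∈ | _      = inj₁ (inj₁ u∈)
... | no _   | yes v∈ = inj₁ (inj₂ v∈)
... | no u∉  | no v∉  = inj₂ (u∉ , v∉)

module _ {σ : Subset n} {ws : List (Fin n)} {u v : Fin n} where

  mesStep-endpoint : mesStep σ ws u v ≡ u ⊎ mesStep σ ws u v ≡ v
  mesStep-endpoint with u ∈? σ | v ∈? σ | any? (u ≟_) ws | any? (v ≟_) ws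
  ... | yes _ | _     | yes _ | _     = inj₁ refl
  ... | yes _ | yes _ | no _  | yes _ = inj₂ refl
  ... | yes _ | yes _ | no _  | no _  = inj₁ refl
  ... | yes _ | no _  | no _  | _     = inj₁ refl
  ... | no _  | yes _ | _     | yes _ = inj₂ refl
  ... | no _  | yes _ | _     | no _  = inj₂ refl
  ... | no _  | no _  | _     | _     = inj₂ refl

  mesStep-∈ : Meets (_∈ σ) (u , v) → mesStep σ ws u v ∈ σ
  mesStep-∈ meets with u ∈? σ | v ∈? σ | any? (u ≟_) ws | any? (v ≟_) ws
  ... | yes u∈ | _      | yes _ | _     = u∈
  ... | yes _  | yes v∈ | no _  | yes _ = v∈
  ... | yes u∈ | yes _  | no _  | no _  = u∈
  ... | yes u∈ | no _   | no _  | _     = u∈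
  ... | no _   | yes v∈ | _     | yes _ = v∈
  ... | no _   | yes v∈ | _     | no _  = v∈
  ... | no u∉  | no v∉  | _     | _     = ⊥-elim ([ u∉ , v∉ ]′ meets)

  -- With ws ⊆ σ ∩ τ, the only question the rule puts to the face is whether u lies in it.
  mesStep-cong : All (_∈ σ) ws → All (_∈ τ) ws → (u ∈ τ → u ∈ σ) →
                 mesStep σ ws u v ∈ τ → mesStep σ ws u v ≡ mesStep τ ws u v
  mesStep-cong {τ} wsσ wsτ u⇐ w∈ with any? (u ≟_) ws | any? (v ≟_) ws
  ... | yes u∈ws | _
    rewrite dec-true (u ∈? σ) (All.lookup wsσ u∈ws) | dec-true (u ∈? τ) (All.lookup wsτ u∈ws) = refl
  ... | no _ | yes v∈ws
    rewrite ∧-zeroʳ (does (u ∈? σ)) | ∧-zeroʳ (does (u ∈? τ))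
          | dec-true (v ∈? σ) (All.lookup wsσ v∈ws) | dec-true (v ∈? τ) (All.lookup wsτ v∈ws) = refl
  ... | no _ | no _
    rewrite ∧-zeroʳ (does (u ∈? σ)) | ∧-zeroʳ (does (u ∈? τ))
          | ∧-zeroʳ (does (v ∈? σ)) | ∧-zeroʳ (does (v ∈? τ))
    with u ∈? σ | u ∈? τ
  ... | yes _  | yes _   = refl
  ... | no _   | no _    = refl
  ... | yes _  | no u∉τ = ⊥-elim (u∉τ w∈)
  ... | no u∉σ | yes u∈τ = ⊥-elim (u∉σ (u⇐ u∈τ))

exclusions : Subset n → List (Fin n) → List (Edge n) → List (Fin n)
exclusions σ ws [] = ws
exclusions σ ws ((u , v) ∷ es) = exclusions σ (ws ++ [ mesStep σ ws u v ]) es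

module _ {σ : Subset n} where

  mesAux-meets : ∀ {ws es} → Meets (_∈ σ) (u , v) →
                 mesAux σ ws ((u , v) ∷ es) ≡ mesAux σ (ws ++ [ mesStep σ ws u v ]) es
  -- The tail call of mesAux carries its own copy of the two tests, hence the rewrites.
  mesAux-meets {u} {v} meets with u ∈? σ | v ∈? σ
  ... | yes u∈ | yes v∈ rewrite dec-true (u ∈? σ) u∈ | dec-true (v ∈? σ) v∈ = refl
  ... | yes u∈ | no v∉  rewrite dec-true (u ∈? σ) u∈ | dec-false (v ∈? σ) v∉ = refl
  ... | no u∉  | yes v∈ rewrite dec-false (u ∈? σ) u∉ | dec-true (v ∈? σ) v∈ = refl
  ... | no u∉  | no v∉  = ⊥-elim ([ u∉ , v∉ ]′ meets)

  mesAux-misses : ∀ {ws es} → Both (_∉ σ) (u , v) → mesAux σ ws ((u , v) ∷ es) ≡ ws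
  mesAux-misses {u} {v} (u∉ , v∉) with u ∈? σ | v ∈? σ
  ... | yes u∈ | _      = ⊥-elim (u∉ u∈)
  ... | no _   | yes v∈ = ⊥-elim (v∉ v∈)
  ... | no _   | no _   = refl

  mesAux-first-miss : ∀ {ws es e es′} → All (Meets (_∈ σ)) es → Both (_∉ σ) e →
                      mesAux σ ws (es ++ e ∷ es′) ≡ exclusions σ ws es
  mesAux-first-miss {e = _ , _} [] misses = mesAux-misses misses
  mesAux-first-miss {es = (_ , _) ∷ _} (meets ∷ es-meet) misses =
    trans (mesAux-meets meets) (mesAux-first-miss es-meet misses)

  exclusions-⊇ : ∀ {ws} es → ws ⊆ₗ exclusions σ ws es
  exclusions-⊇ []             = id
  exclusions-⊇ ((_ , _) ∷ es) = exclusions-⊇ es ∘ ∈-++⁺ˡ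

  exclusions-⊆ : ∀ {ws es} → All (_∈ σ) ws → All (Meets (_∈ σ)) es → All (_∈ σ) (exclusions σ ws es)
  exclusions-⊆ wsσ [] = wsσ
  exclusions-⊆ {ws} {(_ , _) ∷ _} wsσ (meets ∷ es-meet) =
    exclusions-⊆ (Allₚ.++⁺ wsσ (mesStep-∈ {ws = ws} meets ∷ [])) es-meet

  exclusions-meets : ∀ {ws} es → All (Meets (_∈ₗ exclusions σ ws es)) es
  exclusions-meets [] = []
  exclusions-meets {ws} ((u , v) ∷ es) = Sum.map in-excl in-excl (mesStep-endpoint {ws = ws}) ∷ exclusions-meets es
    where
    excl : List (Fin _)
    excl = exclusions σ (ws ++ [ mesStep σ ws u v ]) es
    in-excl : ∀ {x} → mesStep σ ws u v ≡ x → x ∈ₗ excl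
    in-excl w≡x = subst (_∈ₗ excl) w≡x (exclusions-⊇ es (∈-++⁺ʳ ws (here refl)))

  exclusions-cong : ∀ {ws es} → All (_∈ σ) ws → All (Meets (_∈ σ)) es →
                    All ((λ x → x ∈ τ → x ∈ σ) ∘ proj₁) es → All (_∈ τ) (exclusions σ ws es) →
                    exclusions σ ws es ≡ exclusions τ ws es
  exclusions-cong wsσ [] [] _ = refl
  exclusions-cong {τ} {ws} {(u , v) ∷ es} wsσ (meets ∷ es-meet) (u⇐ ∷ es⇐) excl⊆τ = begin
    exclusions σ (ws ++ [ w ]) es                ≡⟨ exclusions-cong wsσ⁺ es-meet es⇐ excl⊆τ ⟩
    exclusions τ (ws ++ [ w ]) es                ≡⟨ cong (λ w → exclusions τ (ws ++ [ w ]) es) w≡ ⟩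
    exclusions τ (ws ++ [ mesStep τ ws u v ]) es ∎
    where
    open ≡-Reasoning
    w : Fin _
    w = mesStep σ ws u v
    wsσ⁺ : All (_∈ σ) (ws ++ [ w ])
    wsσ⁺ = Allₚ.++⁺ wsσ (mesStep-∈ {ws = ws} meets ∷ [])
    ∈τ : ∀ {x} → x ∈ₗ ws ++ [ w ] → x ∈ τ
    ∈τ = All.lookup excl⊆τ ∘ exclusions-⊇ es
    w≡ : w ≡ mesStep τ ws u v
    w≡ = mesStep-cong {v = v} wsσ (All.tabulate (∈τ ∘ ∈-++⁺ˡ)) u⇐ (∈τ (∈-++⁺ʳ ws (here refl)))

isEdgeFrom : Graph n → Fin n → Fin n → Bool
isEdgeFrom G u v = does (u <? v) ∧ adj G u v

block : Graph n → Fin n → List (Edge n)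
block {n} G u = map (u ,_) (filterᵇ (isEdgeFrom G u) (allFin n))

∈-edgeSeq⁺ : (G : Graph n) → u < v → adj G u v ≡ true → (u , v) ∈ₗ edgeSeq G
∈-edgeSeq⁺ {n} {u} {v} G u<v uv =
  Anyₚ.reverse⁺ (∈-concatMap⁺ (block G) (lose {P = ((u , v) ∈ₗ_) ∘ block G} (∈-allFin u) uv∈block))
  where
  uv∈block : (u , v) ∈ₗ block G u
  uv∈block = ∈-map⁺ (u ,_) (∈-filter⁺ (T? ∘ isEdgeFrom G u) (∈-allFin v)
    (Equivalence.from T-∧ (Equivalence.from T-≡ (dec-true (u <? v) u<v) , Equivalence.from T-≡ uv)))

∈-edgeSeq⁻ : (G : Graph n) → (u , v) ∈ₗ edgeSeq G → u < v × adj G u v ≡ true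
∈-edgeSeq⁻ {n} G uv∈ with find (∈-concatMap⁻ (block G) {xs = allFin n} (Anyₚ.reverse⁻ uv∈))
... | u , _ , uv∈block with ∈-map⁻ (u ,_) uv∈block
... | v , v∈ , refl with Equivalence.to T-∧ (proj₂ (∈-filter⁻ (T? ∘ isEdgeFrom G u) {xs = allFin n} v∈))
... | u<v , uv = ℕ.<ᵇ⇒< _ _ u<v , Equivalence.to T-≡ uv  -- does (u <? v) computes to toℕ u <ᵇ toℕ v

block-fst : (G : Graph n) (u : Fin n) → All ((_≡ u) ∘ proj₁) (block G u)
block-fst G u = Allₚ.map⁺ (All.universal (λ _ → refl) _)

edgesAsc-sorted : (G : Graph n) → AllPairs (_≤_ on proj₁) (edgesAsc G)
edgesAsc-sorted {n} G =
  AllPairsₚ.concat⁺ (Allₚ.map⁺ (All.universal within (allFin n)))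
                    (AllPairsₚ.map⁺ (AllPairsₚ.tabulate⁺-< across))
  where
  within : (u : Fin n) → AllPairs (_≤_ on proj₁) (block G u)
  within u = AllPairsₚ.map⁺ (AllPairsₚ.filter⁺ (T? ∘ isEdgeFrom G u)
                                                (AllPairsₚ.tabulate⁺-< {f = id} (λ _ → ℕ.≤-refl)))
  across : ∀ {u u′} → u < u′ → All (λ e → All ((_≤_ on proj₁) e) (block G u′)) (block G u)
  across u<u′ = All.map (λ e≡ → All.map (λ e′≡ → subst₂ _≤_ (≡.sym e≡) (≡.sym e′≡) (ℕ.<⇒≤ u<u′))
                                        (block-fst G _))
                        (block-fst G _)

edgeSeq-sorted : (G : Graph n) → AllPairs (flip (_≤_ on proj₁)) (edgeSeq G)
edgeSeq-sorted G = AllPairs-reverse⁺ (edgesAsc-sorted G)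

edgeSeq-misses : (G : Graph n) → IsFace G σ → Any (Both (_∉ σ)) (edgeSeq G)
edgeSeq-misses G (x , y , x∈ , y∈ , xy) with <-cmp x y
... | tri< x<y _ _ = lose (∈-edgeSeq⁺ G x<y xy) (x∈∁p⇒x∉p x∈ , x∈∁p⇒x∉p y∈)
... | tri≈ _ refl _ with () ← trans (≡.sym xy) (irrefl G x)
... | tri> _ _ y<x = lose (∈-edgeSeq⁺ G y<x (trans (Graph.sym G y x) xy)) (x∈∁p⇒x∉p y∈ , x∈∁p⇒x∉p x∈)

module FirstMissedEdge (G : Graph n) (σ : Subset n) {pre post : List (Edge n)} {a b : Fin n}
  (split : edgeSeq G ≡ pre ++ (a , b) ∷ post)
  (pre-meets : All (Meets (_∈ σ)) pre) (ab-misses : Both (_∉ σ) (a , b)) where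

  W : List (Fin n)
  W = exclusions σ [] pre

  ∈W⊎<a? : Decidable (λ x → x ∈ₗ W ⊎ x < a)
  ∈W⊎<a? x = any? (x ≟_) W ⊎-dec x <? a

  σ′ : Subset n
  σ′ = subset ∈W⊎<a?

  W⊆σ : All (_∈ σ) W
  W⊆σ = exclusions-⊆ [] pre-meets

  W⊆σ′ : All (_∈ σ′) W
  W⊆σ′ = All.tabulate (∈-subset⁺ ∈W⊎<a? ∘ inj₁)

  σ′⊆σ-above-a : a ≤ x → x ∈ σ′ → x ∈ σ
  σ′⊆σ-above-a a≤x x∈ = [ All.lookup W⊆σ , (λ x<a → ⊥-elim (ℕ.≤⇒≯ a≤x x<a)) ]′ (∈-subset⁻ ∈W⊎<a? x∈)

  ∉σ′ : x ∉ σ → ¬ x < a → x ∉ σ′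
  ∉σ′ x∉σ x≮a x∈σ′ = [ x∉σ ∘ All.lookup W⊆σ , x≮a ]′ (∈-subset⁻ ∈W⊎<a? x∈σ′)

  sorted-around-ab : All (λ e → a ≤ proj₁ e) pre × All (λ e → proj₁ e ≤ a) post
  sorted-around-ab = AllPairs-middle⁻ pre (subst (AllPairs _) split (edgeSeq-sorted G))

  ab-edge : a < b × adj G a b ≡ true
  ab-edge = ∈-edgeSeq⁻ G (subst ((a , b) ∈ₗ_) (≡.sym split) (∈-++⁺ʳ pre (here refl)))

  ab-misses′ : Both (_∉ σ′) (a , b)
  ab-misses′ = ∉σ′ (proj₁ ab-misses) (ℕ.<-irrefl refl) , ∉σ′ (proj₂ ab-misses) (ℕ.<-asym (proj₁ ab-edge))

  pre-meets′ : All (Meets (_∈ σ′)) pre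
  pre-meets′ = All.map (Sum.map (All.lookup W⊆σ′) (All.lookup W⊆σ′)) (exclusions-meets pre)

  mes-σ : mes G σ ≡ W
  mes-σ = trans (cong (mesAux σ []) split) (mesAux-first-miss pre-meets ab-misses)

  mes-σ′ : mes G σ′ ≡ exclusions σ′ [] pre
  mes-σ′ = trans (cong (mesAux σ′ []) split) (mesAux-first-miss pre-meets′ ab-misses′)

  W≡ : W ≡ exclusions σ′ [] pre
  W≡ = exclusions-cong [] pre-meets (All.map σ′⊆σ-above-a (proj₁ sorted-around-ab)) W⊆σ′

  mes-preserved : mes G σ ≡ mes G σ′
  mes-preserved = trans mes-σ (trans W≡ (≡.sym mes-σ′))

  ∈-pre : ∀ {u v} → a < u → (u , v) ∈ₗ edgeSeq G → (u , v) ∈ₗ pre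
  ∈-pre a<u uv∈ with ∈-++⁻ pre (subst ((_ , _) ∈ₗ_) split uv∈)
  ... | inj₁ uv∈pre          = uv∈pre
  ... | inj₂ (here refl)     = ⊥-elim (ℕ.<-irrefl refl a<u)
  ... | inj₂ (there uv∈post) = ⊥-elim (ℕ.≤⇒≯ (All.lookup (proj₂ sorted-around-ab) uv∈post) a<u)

  edge-from-a : u < v → adj G u v ≡ true → u ∉ σ′ → v ∉ σ′ → u ≡ a × a < v
  edge-from-a {u} u<v uv u∉ v∉ with <-cmp a u
  ... | tri≈ _ refl _ = refl , u<v
  ... | tri> _ _ u<a = ⊥-elim (u∉ (∈-subset⁺ ∈W⊎<a? (inj₂ u<a)))
  ... | tri< a<u _ _ = ⊥-elim ([ u∉ , v∉ ]′ (All.lookup pre-meets′ (∈-pre a<u (∈-edgeSeq⁺ G u<v uv))))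

  star : StarWithCenter G (∁ σ′) a
  star = x∉p⇒x∈∁p (proj₁ ab-misses′) , oriented
    where
    oriented : ∀ u v → u ∈ ∁ σ′ → v ∈ ∁ σ′ → adj G u v ≡ true → (u ≡ a × a < v) ⊎ (v ≡ a × a < u)
    oriented u v u∈ v∈ uv with <-cmp u v
    ... | tri< u<v _ _ = inj₁ (edge-from-a u<v uv (x∈∁p⇒x∉p u∈) (x∈∁p⇒x∉p v∈))
    ... | tri≈ _ refl _ with () ← trans (≡.sym uv) (irrefl G u)
    ... | tri> _ _ v<u = inj₂ (edge-from-a v<u (trans (Graph.sym G v u) uv) (x∈∁p⇒x∉p v∈) (x∈∁p⇒x∉p u∈))

  face′ : IsFace G σ′
  face′ = a , b , x∉p⇒x∈∁p (proj₁ ab-misses′) , x∉p⇒x∈∁p (proj₂ ab-misses′) , proj₂ ab-edge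

lemma2p1 : ∀ {n : ℕ} (G : Graph n) (σ : Subset n) → IsFace G σ →
    ∃[ σ' ] (IsFace G σ' × mes G σ ≡ mes G σ' × ∃[ a ] StarWithCenter G (∁ σ') a)
lemma2p1 G σ face = witness (toView first-miss) refl
  where
  first-miss : First (Meets (_∈ σ)) (Both (_∉ σ)) (edgeSeq G)
  first-miss = refine (λ {e} _ → Sum.swap (meets-or-misses σ e)) (fromAny (edgeSeq-misses G face))
  witness : ∀ {es} → FirstView (Meets (_∈ σ)) (Both (_∉ σ)) es → edgeSeq G ≡ es →
            ∃[ σ' ] (IsFace G σ' × mes G σ ≡ mes G σ' × ∃[ a ] StarWithCenter G (∁ σ') a)
  witness (First._++_∷_ {y = _ , _} pre-meets ab-misses _) split =
    σ′ , face′ , mes-preserved , _ , star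
    where open FirstMissedEdge G σ split pre-meets ab-misses
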